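{- If $A$ is a good pseudo-hoop, then a subset $F\subseteq A$ is a fantastic filter of $A$ if and only if it is an involutive filter of $A$.
   Context: A pseudo-hoop is an algebra $(A,\odot,\rightarrow,\rightsquigarrow,1)$ of type $(2,2,2,0)$ such that for all $x,y,z\in A$: $x\odot 1=1\odot x=x$; $x\rightarrow x=x\rightsquigarrow x=1$; $(x\odot y)\rightarrow z=x\rightarrow(y\rightarrow z)$; $(x\odot y)\rightsquigarrow z=y\rightsquigarrow(x\rightsquigarrow z)$; $(x\rightarrow y)\odot x=(y\rightarrow x)\odot y=x\odot(x\rightsquigarrow y)=y\odot(y\rightsquigarrow x)$. The order is $x\le y$ iff $x\rightarrow y=1$. It is bounded if it has a least element $0$; then $x^-=x\rightarrow 0$, $x^\sim=x\rightsquigarrow 0$, $x^{ -\sim}=(x^-)^\sim$, $x^{\sim- }=(x^\sim)^-$; it is good if $x^{ -\sim}=x^{\sim- }$ for all $x$. Put $x\vee_1 y=(x\rightarrow y)\rightsquigarrow y$, $x\vee_2 y=(x\rightsquigarrow y)\rightarrow y$. A filter is a nonempty $F\subseteq A$ closed under $\odot$ and upward closed. A filter $F$ is involutive if $x^{ -\sim}\rightarrow x\in F$ and $x^{\sim- }\rightsquigarrow x\in F$ for all $x$; it is fantastic if for all $x,y$: $y\rightarrow x\in F$ implies $x\vee_1 y\rightarrow x\in F$, and $y\rightsquigarrow x\in F$ implies $x\vee_2 y\rightsquigarrow x\in F$. -}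

module Defs where

open import Level using (Level; _⊔_; suc)
open import Relation.Binary.PropositionalEquality using (_≡_)
open import Relation.Unary using (Pred; _∈_)
open import Data.Product using (_×_; ∃)

record BoundedPseudoHoop (a : Level) : Set (suc a) where
  infixl 7 _⊙_
  infixr 5 _⇒_ _⇝_
  field
    Carrier : Set a
    _⊙_     : Carrier → Carrier → Carrier
    _⇒_     : Carrier → Carrier → Carrier
    _⇝_     : Carrier → Carrier → Carrier
    𝟙       : Carrier
    𝟘       : Carrier
    ⊙-identityʳ : ∀ x → x ⊙ 𝟙 ≡ x
    ⊙-identityˡ : ∀ x → 𝟙 ⊙ x ≡ x
    ⇒-refl      : ∀ x → x ⇒ x ≡ 𝟙
    ⇝-refl      : ∀ x → x ⇝ x ≡ 𝟙
    ⇒-curry     : ∀ x y z → (x ⊙ y) ⇒ z ≡ x ⇒ (y ⇒ z)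
    ⇝-curry     : ∀ x y z → (x ⊙ y) ⇝ z ≡ y ⇝ (x ⇝ z)
    div₁        : ∀ x y → (x ⇒ y) ⊙ x ≡ (y ⇒ x) ⊙ y
    div₂        : ∀ x y → (y ⇒ x) ⊙ y ≡ x ⊙ (x ⇝ y)
    div₃        : ∀ x y → x ⊙ (x ⇝ y) ≡ y ⊙ (y ⇝ x)
    𝟘-least     : ∀ x → 𝟘 ⇒ x ≡ 𝟙

  _≤_ : Carrier → Carrier → Set a
  x ≤ y = x ⇒ y ≡ 𝟙

  _⁻ : Carrier → Carrier
  x ⁻ = x ⇒ 𝟘

  _∼ : Carrier → Carrier
  x ∼ = x ⇝ 𝟘

  _∨₁_ : Carrier → Carrier → Carrier
  x ∨₁ y = (x ⇒ y) ⇝ y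

  _∨₂_ : Carrier → Carrier → Carrier
  x ∨₂ y = (x ⇝ y) ⇒ y

  IsGood : Set a
  IsGood = ∀ x → (x ⁻) ∼ ≡ (x ∼) ⁻

  IsFilter : ∀ {ℓ} → Pred Carrier ℓ → Set (a ⊔ ℓ)
  IsFilter F =
    ∃ (λ x → x ∈ F)
    × (∀ x y → x ∈ F → y ∈ F → (x ⊙ y) ∈ F)
    × (∀ x y → x ∈ F → x ≤ y → y ∈ F)

  IsInvolutiveFilter : ∀ {ℓ} → Pred Carrier ℓ → Set (a ⊔ ℓ)
  IsInvolutiveFilter F =
    IsFilter F
    × (∀ x → ((x ⁻) ∼ ⇒ x) ∈ F)
    × (∀ x → ((x ∼) ⁻ ⇝ x) ∈ F)

  IsFantasticFilter : ∀ {ℓ} → Pred Carrier ℓ → Set (a ⊔ ℓ)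
  IsFantasticFilter F =
    IsFilter F
    × (∀ x y → (y ⇒ x) ∈ F → ((x ∨₁ y) ⇒ x) ∈ F)
    × (∀ x y → (y ⇝ x) ∈ F → ((x ∨₂ y) ⇝ x) ∈ F)

-- Fantastic ⇒ involutive is the instance y = 𝟘 of the fantastic condition:
-- 𝟘 ⇒ x = 𝟙 lies in F and x ∨₁ 𝟘 is x⁻∼.  Conversely, goodness gives
-- (x⁻∼ ⇒ x)∼ = 𝟘 and from it the Glivenko inequality x ⇒ y⁻∼ ≤ (x ⇒ y)⁻∼,
-- which yields y ⇒ x ≤ (x ∨₁ y) ⇒ x⁻∼.  Multiplying by x⁻∼ ⇒ x ∈ F and
-- composing implications puts (x ∨₁ y) ⇒ x in F.  The condition for ⇝ and ∨₂
-- is the same argument in the opposite pseudo-hoop.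

module Submission where

open import Defs
open import Level using (Level)
open import Relation.Unary using (Pred; _∈_)
open import Data.Product using (_×_; _,_)
open import Relation.Binary.Bundles using (Poset)
open import Relation.Binary.PropositionalEquality
  using (_≡_; refl; sym; trans; cong; subst; isEquivalence; module ≡-Reasoning)
import Relation.Binary.Reasoning.PartialOrder as PosetReasoning

module Order {a : Level} (A : BoundedPseudoHoop a) where
  open BoundedPseudoHoop A
  open ≡-Reasoning

  ≤-factorˡ : ∀ {x y} → x ≤ y → (y ⇒ x) ⊙ y ≡ x
  ≤-factorˡ {x} {y} x≤y = begin
    (y ⇒ x) ⊙ y  ≡⟨ div₁ x y ⟨
    (x ⇒ y) ⊙ x  ≡⟨ cong (_⊙ x) x≤y ⟩
    𝟙 ⊙ x        ≡⟨ ⊙-identityˡ x ⟩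
    x            ∎

  ≤-factorʳ : ∀ {x y} → x ≤ y → y ⊙ (y ⇝ x) ≡ x
  ≤-factorʳ {x} {y} x≤y = trans (sym (trans (div₂ x y) (div₃ x y))) (≤-factorˡ x≤y)

  ≤-antisym : ∀ {x y} → x ≤ y → y ≤ x → x ≡ y
  ≤-antisym {x} {y} x≤y y≤x = begin
    x            ≡⟨ ≤-factorˡ x≤y ⟨
    (y ⇒ x) ⊙ y  ≡⟨ cong (_⊙ y) y≤x ⟩
    𝟙 ⊙ y        ≡⟨ ⊙-identityˡ y ⟩
    y            ∎

  𝟙⇒[x⇒y]≡x⇒y : ∀ x y → 𝟙 ⇒ (x ⇒ y) ≡ x ⇒ y
  𝟙⇒[x⇒y]≡x⇒y x y = trans (sym (⇒-curry 𝟙 x y)) (cong (_⇒ y) (⊙-identityˡ x))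

  𝟙⇒x≡[x⇒𝟙]⊙x : ∀ x → 𝟙 ⇒ x ≡ (x ⇒ 𝟙) ⊙ x
  𝟙⇒x≡[x⇒𝟙]⊙x x = trans (sym (⊙-identityʳ (𝟙 ⇒ x))) (sym (div₁ x 𝟙))

  𝟙⇒x≤𝟙 : ∀ x → (𝟙 ⇒ x) ≤ 𝟙
  𝟙⇒x≤𝟙 x = begin
    (𝟙 ⇒ x) ⇒ 𝟙              ≡⟨ cong (_⇒ 𝟙) (𝟙⇒x≡[x⇒𝟙]⊙x x) ⟩
    ((x ⇒ 𝟙) ⊙ x) ⇒ 𝟙        ≡⟨ ⇒-curry (x ⇒ 𝟙) x 𝟙 ⟩
    (x ⇒ 𝟙) ⇒ (x ⇒ 𝟙)        ≡⟨ ⇒-refl (x ⇒ 𝟙) ⟩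
    𝟙                        ∎

  x≤𝟙 : ∀ x → x ≤ 𝟙
  x≤𝟙 x = begin
    x ⇒ 𝟙                         ≡⟨ cong (_⇒ 𝟙) (≤-factorˡ x≤𝟙⇒x) ⟨
    (((𝟙 ⇒ x) ⇒ x) ⊙ (𝟙 ⇒ x)) ⇒ 𝟙  ≡⟨ ⇒-curry ((𝟙 ⇒ x) ⇒ x) (𝟙 ⇒ x) 𝟙 ⟩
    ((𝟙 ⇒ x) ⇒ x) ⇒ ((𝟙 ⇒ x) ⇒ 𝟙)  ≡⟨ cong (((𝟙 ⇒ x) ⇒ x) ⇒_) (𝟙⇒x≤𝟙 x) ⟩
    ((𝟙 ⇒ x) ⇒ x) ⇒ 𝟙             ≡⟨ cong (_⇒ 𝟙) [𝟙⇒x]⇒x≡[x⇒𝟙]⇒𝟙 ⟩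
    ((x ⇒ 𝟙) ⇒ 𝟙) ⇒ 𝟙             ≡⟨ cong (_⇒ 𝟙) (𝟙⇒[x⇒y]≡x⇒y (x ⇒ 𝟙) 𝟙) ⟨
    (𝟙 ⇒ ((x ⇒ 𝟙) ⇒ 𝟙)) ⇒ 𝟙       ≡⟨ 𝟙⇒x≤𝟙 ((x ⇒ 𝟙) ⇒ 𝟙) ⟩
    𝟙                             ∎
    where
    x≤𝟙⇒x : x ≤ (𝟙 ⇒ x)
    x≤𝟙⇒x = trans (sym (⇒-curry x 𝟙 x)) (trans (cong (_⇒ x) (⊙-identityʳ x)) (⇒-refl x))

    [𝟙⇒x]⇒x≡[x⇒𝟙]⇒𝟙 : (𝟙 ⇒ x) ⇒ x ≡ (x ⇒ 𝟙) ⇒ 𝟙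
    [𝟙⇒x]⇒x≡[x⇒𝟙]⇒𝟙 = begin
      (𝟙 ⇒ x) ⇒ x          ≡⟨ cong (_⇒ x) (𝟙⇒x≡[x⇒𝟙]⊙x x) ⟩
      ((x ⇒ 𝟙) ⊙ x) ⇒ x    ≡⟨ ⇒-curry (x ⇒ 𝟙) x x ⟩
      (x ⇒ 𝟙) ⇒ (x ⇒ x)    ≡⟨ cong ((x ⇒ 𝟙) ⇒_) (⇒-refl x) ⟩
      (x ⇒ 𝟙) ⇒ 𝟙          ∎

  ≤⇒⇝≡𝟙 : ∀ {x y} → x ≤ y → x ⇝ y ≡ 𝟙
  ≤⇒⇝≡𝟙 {x} {y} x≤y = begin
    x ⇝ y                  ≡⟨ cong (_⇝ y) x⊙[x⇝y]≡x ⟨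
    (x ⊙ (x ⇝ y)) ⇝ y      ≡⟨ ⇝-curry x (x ⇝ y) y ⟩
    (x ⇝ y) ⇝ (x ⇝ y)      ≡⟨ ⇝-refl (x ⇝ y) ⟩
    𝟙                      ∎
    where
    x⊙[x⇝y]≡x : x ⊙ (x ⇝ y) ≡ x
    x⊙[x⇝y]≡x = begin
      x ⊙ (x ⇝ y)   ≡⟨ trans (div₁ x y) (div₂ x y) ⟨
      (x ⇒ y) ⊙ x   ≡⟨ cong (_⊙ x) x≤y ⟩
      𝟙 ⊙ x         ≡⟨ ⊙-identityˡ x ⟩
      x             ∎

-- Reversing ⊙ and interchanging ⇒ with ⇝ gives again a bounded pseudo-hoop,
-- whose order is x ⇝ y ≡ 𝟙; this mirrors every fact about ⇒ into one about ⇝.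
opposite : ∀ {a} → BoundedPseudoHoop a → BoundedPseudoHoop a
opposite A = record
  { Carrier     = Carrier
  ; _⊙_         = λ x y → y ⊙ x
  ; _⇒_         = _⇝_
  ; _⇝_         = _⇒_
  ; 𝟙           = 𝟙
  ; 𝟘           = 𝟘
  ; ⊙-identityʳ = ⊙-identityˡ
  ; ⊙-identityˡ = ⊙-identityʳ
  ; ⇒-refl      = ⇝-refl
  ; ⇝-refl      = ⇒-refl
  ; ⇒-curry     = λ x y z → ⇝-curry y x z
  ; ⇝-curry     = λ x y z → ⇒-curry y x z
  ; div₁        = div₃
  ; div₂        = λ x y → sym (trans (div₁ x y) (trans (div₂ x y) (div₃ x y)))
  ; div₃        = div₁
  ; 𝟘-least     = λ x → ≤⇒⇝≡𝟙 (𝟘-least x)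
  }
  where
  open BoundedPseudoHoop A
  open Order A

module Properties {a : Level} (A : BoundedPseudoHoop a) where
  open BoundedPseudoHoop A
  open Order A public

  ⇝≡𝟙⇒≤ : ∀ {x y} → x ⇝ y ≡ 𝟙 → x ≤ y
  ⇝≡𝟙⇒≤ = Order.≤⇒⇝≡𝟙 (opposite A)

  ≤-refl : ∀ {x} → x ≤ x
  ≤-refl {x} = ⇒-refl x

  ≤-trans : ∀ {x y z} → x ≤ y → y ≤ z → x ≤ z
  ≤-trans {x} {y} {z} x≤y y≤z = begin
    x ⇒ z                ≡⟨ cong (_⇒ z) (≤-factorˡ x≤y) ⟨
    ((y ⇒ x) ⊙ y) ⇒ z    ≡⟨ ⇒-curry (y ⇒ x) y z ⟩
    (y ⇒ x) ⇒ (y ⇒ z)    ≡⟨ cong ((y ⇒ x) ⇒_) y≤z ⟩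
    (y ⇒ x) ⇒ 𝟙          ≡⟨ x≤𝟙 (y ⇒ x) ⟩
    𝟙                    ∎
    where open ≡-Reasoning

  ≤-poset : Poset a a a
  ≤-poset = record
    { _≈_            = _≡_
    ; _≤_            = _≤_
    ; isPartialOrder = record
      { isPreorder = record
        { isEquivalence = isEquivalence
        ; reflexive     = λ { refl → ≤-refl }
        ; trans         = ≤-trans
        }
      ; antisym    = ≤-antisym
      }
    }

  open PosetReasoning ≤-poset

  ⊙-assoc : ∀ x y z → (x ⊙ y) ⊙ z ≡ x ⊙ (y ⊙ z)
  ⊙-assoc x y z = ≤-antisym
    (trans (same-residuals (x ⊙ (y ⊙ z))) (⇒-refl (x ⊙ (y ⊙ z))))
    (trans (sym (same-residuals ((x ⊙ y) ⊙ z))) (⇒-refl ((x ⊙ y) ⊙ z)))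
    where
    same-residuals : ∀ w → ((x ⊙ y) ⊙ z) ⇒ w ≡ (x ⊙ (y ⊙ z)) ⇒ w
    same-residuals w = begin-equality
      ((x ⊙ y) ⊙ z) ⇒ w    ≡⟨ ⇒-curry (x ⊙ y) z w ⟩
      (x ⊙ y) ⇒ (z ⇒ w)    ≡⟨ ⇒-curry x y (z ⇒ w) ⟩
      x ⇒ (y ⇒ (z ⇒ w))    ≡⟨ cong (x ⇒_) (⇒-curry y z w) ⟨
      x ⇒ ((y ⊙ z) ⇒ w)    ≡⟨ ⇒-curry x (y ⊙ z) w ⟨
      (x ⊙ (y ⊙ z)) ⇒ w    ∎

  ⇒-curry-≤ : ∀ {x y z} → (x ⊙ y) ≤ z → x ≤ (y ⇒ z)
  ⇒-curry-≤ {x} {y} {z} = trans (sym (⇒-curry x y z))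

  ⇒-uncurry-≤ : ∀ {x y z} → x ≤ (y ⇒ z) → (x ⊙ y) ≤ z
  ⇒-uncurry-≤ {x} {y} {z} = trans (⇒-curry x y z)

  ⇝-curry-≤ : ∀ {x y z} → (x ⊙ y) ≤ z → y ≤ (x ⇝ z)
  ⇝-curry-≤ {x} {y} {z} xy≤z = ⇝≡𝟙⇒≤ (trans (sym (⇝-curry x y z)) (≤⇒⇝≡𝟙 xy≤z))

  ⇝-uncurry-≤ : ∀ {x y z} → y ≤ (x ⇝ z) → (x ⊙ y) ≤ z
  ⇝-uncurry-≤ {x} {y} {z} y≤x⇝z = ⇝≡𝟙⇒≤ (trans (⇝-curry x y z) (≤⇒⇝≡𝟙 y≤x⇝z))

  ⇒-mp : ∀ {x y} → ((x ⇒ y) ⊙ x) ≤ y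
  ⇒-mp = ⇒-uncurry-≤ ≤-refl

  ⇝-mp : ∀ {x y} → (x ⊙ (x ⇝ y)) ≤ y
  ⇝-mp = ⇝-uncurry-≤ ≤-refl

  ⊙-monoˡ-≤ : ∀ {x y z} → y ≤ z → (y ⊙ x) ≤ (z ⊙ x)
  ⊙-monoˡ-≤ y≤z = ⇒-uncurry-≤ (≤-trans y≤z (⇒-curry-≤ ≤-refl))

  ⊙-monoʳ-≤ : ∀ {x y z} → y ≤ z → (x ⊙ y) ≤ (x ⊙ z)
  ⊙-monoʳ-≤ y≤z = ⇝-uncurry-≤ (≤-trans y≤z (⇝-curry-≤ ≤-refl))

  ⇒-monoʳ-≤ : ∀ {x y z} → y ≤ z → (x ⇒ y) ≤ (x ⇒ z)
  ⇒-monoʳ-≤ y≤z = ⇒-curry-≤ (≤-trans ⇒-mp y≤z)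

  ⇒-antimonoˡ-≤ : ∀ {x y z} → x ≤ y → (y ⇒ z) ≤ (x ⇒ z)
  ⇒-antimonoˡ-≤ x≤y = ⇒-curry-≤ (≤-trans (⊙-monoʳ-≤ x≤y) ⇒-mp)

  ⇝-monoʳ-≤ : ∀ {x y z} → y ≤ z → (x ⇝ y) ≤ (x ⇝ z)
  ⇝-monoʳ-≤ y≤z = ⇝-curry-≤ (≤-trans ⇝-mp y≤z)

  ⇝-antimonoˡ-≤ : ∀ {x y z} → x ≤ y → (y ⇝ z) ≤ (x ⇝ z)
  ⇝-antimonoˡ-≤ x≤y = ⇝-curry-≤ (≤-trans (⊙-monoˡ-≤ x≤y) ⇝-mp)

  x≤[x⇒y]⇝y : ∀ x y → x ≤ ((x ⇒ y) ⇝ y)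
  x≤[x⇒y]⇝y x y = ⇝-curry-≤ ⇒-mp

  x≤[x⇝y]⇒y : ∀ x y → x ≤ ((x ⇝ y) ⇒ y)
  x≤[x⇝y]⇒y x y = ⇒-curry-≤ ⇝-mp

  ⇒-trans : ∀ {x y z} → ((y ⇒ z) ⊙ (x ⇒ y)) ≤ (x ⇒ z)
  ⇒-trans {x} {y} {z} = ⇒-curry-≤ (begin
    ((y ⇒ z) ⊙ (x ⇒ y)) ⊙ x  ≡⟨ ⊙-assoc (y ⇒ z) (x ⇒ y) x ⟩
    (y ⇒ z) ⊙ ((x ⇒ y) ⊙ x)  ≤⟨ ⊙-monoʳ-≤ ⇒-mp ⟩
    (y ⇒ z) ⊙ y              ≤⟨ ⇒-mp ⟩
    z                        ∎)

  ⇒-⇝-exchange : ∀ x y z → x ⇒ (y ⇝ z) ≡ y ⇝ (x ⇒ z)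
  ⇒-⇝-exchange x y z = ≤-antisym
    (⇝-curry-≤ (⇒-curry-≤ (begin
      (y ⊙ (x ⇒ (y ⇝ z))) ⊙ x  ≡⟨ ⊙-assoc y (x ⇒ (y ⇝ z)) x ⟩
      y ⊙ ((x ⇒ (y ⇝ z)) ⊙ x)  ≤⟨ ⊙-monoʳ-≤ ⇒-mp ⟩
      y ⊙ (y ⇝ z)              ≤⟨ ⇝-mp ⟩
      z                        ∎)))
    (⇒-curry-≤ (⇝-curry-≤ (begin
      y ⊙ ((y ⇝ (x ⇒ z)) ⊙ x)  ≡⟨ ⊙-assoc y (y ⇝ (x ⇒ z)) x ⟨
      (y ⊙ (y ⇝ (x ⇒ z))) ⊙ x  ≤⟨ ⊙-monoˡ-≤ ⇝-mp ⟩
      (x ⇒ z) ⊙ x              ≤⟨ ⇒-mp ⟩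
      z                        ∎)))

  _⁻∼ : Carrier → Carrier
  x ⁻∼ = (x ⁻) ∼

  ∼⁻∼≡∼ : ∀ x → ((x ∼) ⁻) ∼ ≡ x ∼
  ∼⁻∼≡∼ x = ≤-antisym (⇝-antimonoˡ-≤ (x≤[x⇝y]⇒y x 𝟘)) (x≤[x⇒y]⇝y (x ∼) 𝟘)

  ∨₁-⁻∼-comm : ∀ x y → x ∨₁ (y ⁻∼) ≡ y ∨₁ (x ⁻∼)
  ∨₁-⁻∼-comm x y = begin-equality
    x ∨₁ (y ⁻∼)                ≡⟨ ∨₁⁻∼≡ x y ⟩
    (y ⁻ ⊙ (y ⁻ ⇝ x ⁻)) ∼      ≡⟨ cong _∼ (div₃ (y ⁻) (x ⁻)) ⟩
    (x ⁻ ⊙ (x ⁻ ⇝ y ⁻)) ∼      ≡⟨ ∨₁⁻∼≡ y x ⟨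
    y ∨₁ (x ⁻∼)                ∎
    where
    ∨₁⁻∼≡ : ∀ x y → x ∨₁ (y ⁻∼) ≡ (y ⁻ ⊙ (y ⁻ ⇝ x ⁻)) ∼
    ∨₁⁻∼≡ x y = begin-equality
      (x ⇒ (y ⁻ ⇝ 𝟘)) ⇝ y ⁻∼     ≡⟨ cong (_⇝ y ⁻∼) (⇒-⇝-exchange x (y ⁻) 𝟘) ⟩
      (y ⁻ ⇝ x ⁻) ⇝ (y ⁻ ⇝ 𝟘)    ≡⟨ ⇝-curry (y ⁻) (y ⁻ ⇝ x ⁻) 𝟘 ⟨
      (y ⁻ ⊙ (y ⁻ ⇝ x ⁻)) ∼      ∎

  opposite-isGood : IsGood → BoundedPseudoHoop.IsGood (opposite A)
  opposite-isGood good x = sym (good x)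

  module _ {ℓ} {F : Pred Carrier ℓ} where

    filter-∋-𝟙 : IsFilter F → 𝟙 ∈ F
    filter-∋-𝟙 ((x , x∈F) , _ , ≤-closed) = ≤-closed x 𝟙 x∈F (x≤𝟙 x)

    opposite-isFilter : IsFilter F → BoundedPseudoHoop.IsFilter (opposite A) F
    opposite-isFilter (nonempty , ⊙-closed , ≤-closed) =
      nonempty ,
      (λ x y x∈F y∈F → ⊙-closed y x y∈F x∈F) ,
      (λ x y x∈F x⇝y≡𝟙 → ≤-closed x y x∈F (⇝≡𝟙⇒≤ x⇝y≡𝟙))

module Good {a : Level} (A : BoundedPseudoHoop a) (good : BoundedPseudoHoop.IsGood A) where
  open BoundedPseudoHoop A
  open Properties A
  open PosetReasoning ≤-poset

  ⁻∼∼≡∼ : ∀ x → (x ⁻∼) ∼ ≡ x ∼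
  ⁻∼∼≡∼ x = trans (cong _∼ (good x)) (∼⁻∼≡∼ x)

  x⇝y⁻∼≡x⁻∼⇝y⁻∼ : ∀ x y → x ⇝ y ⁻∼ ≡ x ⁻∼ ⇝ y ⁻∼
  x⇝y⁻∼≡x⁻∼⇝y⁻∼ x y = begin-equality
    x ⇝ y ⁻∼               ≡⟨ cong (x ⇝_) (good y) ⟩
    x ⇝ (y ∼ ⇒ 𝟘)          ≡⟨ ⇒-⇝-exchange (y ∼) x 𝟘 ⟨
    y ∼ ⇒ x ∼              ≡⟨ cong (y ∼ ⇒_) (⁻∼∼≡∼ x) ⟨
    y ∼ ⇒ (x ⁻∼) ∼         ≡⟨ ⇒-⇝-exchange (y ∼) (x ⁻∼) 𝟘 ⟩
    x ⁻∼ ⇝ (y ∼ ⇒ 𝟘)       ≡⟨ cong (x ⁻∼ ⇝_) (good y) ⟨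
    x ⁻∼ ⇝ y ⁻∼            ∎

  [x⁻∼⇒x]∼≤𝟘 : ∀ x → ((x ⁻∼ ⇒ x) ∼) ≤ 𝟘
  [x⁻∼⇒x]∼≤𝟘 x = begin
    t ∼                        ≡⟨ ≤-factorʳ t∼≤x⁻∼ ⟨
    x ⁻∼ ⊙ (x ⁻∼ ⇝ t ∼)        ≡⟨ cong (x ⁻∼ ⊙_) (⇝-curry t (x ⁻∼) 𝟘) ⟨
    x ⁻∼ ⊙ (t ⊙ x ⁻∼) ∼        ≡⟨ cong (λ w → x ⁻∼ ⊙ w ∼) (≤-factorˡ (x≤[x⇒y]⇝y x 𝟘)) ⟩
    x ⁻∼ ⊙ x ∼                 ≡⟨ cong (_⊙ x ∼) (good x) ⟩
    (x ∼ ⇒ 𝟘) ⊙ x ∼            ≤⟨ ⇒-mp ⟩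
    𝟘                          ∎
    where
    t = x ⁻∼ ⇒ x
    t∼≤x⁻∼ : (t ∼) ≤ (x ⁻∼)
    t∼≤x⁻∼ = ⇝-antimonoˡ-≤ (⇒-curry-≤ (≤-trans ⇝-mp (𝟘-least x)))

  glivenko : ∀ x y → (x ⇒ y ⁻∼) ≤ ((x ⇒ y) ⁻∼)
  glivenko x y = subst ((x ⇒ y ⁻∼) ≤_) (sym (good (x ⇒ y))) (⇒-curry-≤ (begin
    c ⊙ b ∼            ≤⟨ ⇝-curry-≤ b-cancels ⟩
    (c ⇒ b) ∼          ≤⟨ ⇝-antimonoˡ-≤ y⁻∼⇒y≤c⇒b ⟩
    (y ⁻∼ ⇒ y) ∼       ≤⟨ [x⁻∼⇒x]∼≤𝟘 y ⟩
    𝟘                  ∎))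
    where
    b = x ⇒ y
    c = x ⇒ y ⁻∼
    b-cancels : ((c ⇒ b) ⊙ (c ⊙ b ∼)) ≤ 𝟘
    b-cancels = begin
      (c ⇒ b) ⊙ (c ⊙ b ∼)   ≡⟨ ⊙-assoc (c ⇒ b) c (b ∼) ⟨
      ((c ⇒ b) ⊙ c) ⊙ b ∼   ≡⟨ cong (_⊙ b ∼) (≤-factorˡ (⇒-monoʳ-≤ (x≤[x⇒y]⇝y y 𝟘))) ⟩
      b ⊙ b ∼               ≤⟨ ⇝-mp ⟩
      𝟘                     ∎
    y⁻∼⇒y≤c⇒b : (y ⁻∼ ⇒ y) ≤ (c ⇒ b)
    y⁻∼⇒y≤c⇒b = begin
      y ⁻∼ ⇒ y       ≤⟨ ⇒-antimonoˡ-≤ ⇒-mp ⟩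
      (c ⊙ x) ⇒ y    ≡⟨ ⇒-curry c x y ⟩
      c ⇒ b          ∎

  x∨₁y≤y∨₁x⁻∼ : ∀ x y → (x ∨₁ y) ≤ (y ∨₁ (x ⁻∼))
  x∨₁y≤y∨₁x⁻∼ x y = begin
    (x ⇒ y) ⇝ y            ≤⟨ ⇝-monoʳ-≤ (x≤[x⇒y]⇝y y 𝟘) ⟩
    (x ⇒ y) ⇝ y ⁻∼         ≡⟨ x⇝y⁻∼≡x⁻∼⇝y⁻∼ (x ⇒ y) y ⟩
    (x ⇒ y) ⁻∼ ⇝ y ⁻∼      ≤⟨ ⇝-antimonoˡ-≤ (glivenko x y) ⟩
    (x ⇒ y ⁻∼) ⇝ y ⁻∼      ≡⟨ ∨₁-⁻∼-comm x y ⟩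
    (y ⇒ x ⁻∼) ⇝ x ⁻∼      ∎

  y⇒x≤[x∨₁y]⇒x⁻∼ : ∀ x y → (y ⇒ x) ≤ ((x ∨₁ y) ⇒ x ⁻∼)
  y⇒x≤[x∨₁y]⇒x⁻∼ x y = begin
    y ⇒ x                   ≤⟨ ⇒-monoʳ-≤ (x≤[x⇒y]⇝y x 𝟘) ⟩
    y ⇒ x ⁻∼                ≤⟨ x≤[x⇝y]⇒y (y ⇒ x ⁻∼) (x ⁻∼) ⟩
    (y ∨₁ (x ⁻∼)) ⇒ x ⁻∼    ≤⟨ ⇒-antimonoˡ-≤ (x∨₁y≤y∨₁x⁻∼ x y) ⟩
    (x ∨₁ y) ⇒ x ⁻∼         ∎

  involutive⇒fantastic₁ : ∀ {ℓ} {F : Pred Carrier ℓ} → IsFilter F →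
                          (∀ x → (x ⁻∼ ⇒ x) ∈ F) →
                          ∀ x y → (y ⇒ x) ∈ F → ((x ∨₁ y) ⇒ x) ∈ F
  involutive⇒fantastic₁ {F = F} (_ , ⊙-closed , ≤-closed) involutive x y y⇒x∈F =
    ≤-closed _ _ (⊙-closed _ _ (involutive x) [x∨₁y]⇒x⁻∼∈F) ⇒-trans
    where
    [x∨₁y]⇒x⁻∼∈F : ((x ∨₁ y) ⇒ x ⁻∼) ∈ F
    [x∨₁y]⇒x⁻∼∈F = ≤-closed _ _ y⇒x∈F (y⇒x≤[x∨₁y]⇒x⁻∼ x y)

fantastic⇒involutive : ∀ {a ℓ} (A : BoundedPseudoHoop a) {F : Pred (BoundedPseudoHoop.Carrier A) ℓ} →
                       BoundedPseudoHoop.IsFantasticFilter A F → BoundedPseudoHoop.IsInvolutiveFilter A F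
fantastic⇒involutive A {F} (filter , fantastic₁ , fantastic₂) =
  filter ,
  (λ x → fantastic₁ x 𝟘 (subst (_∈ F) (sym (𝟘-least x)) 𝟙∈F)) ,
  (λ x → fantastic₂ x 𝟘 (subst (_∈ F) (sym (≤⇒⇝≡𝟙 (𝟘-least x))) 𝟙∈F))
  where
  open BoundedPseudoHoop A
  open Properties A
  𝟙∈F : 𝟙 ∈ F
  𝟙∈F = filter-∋-𝟙 filter

involutive⇒fantastic : ∀ {a ℓ} (A : BoundedPseudoHoop a) {F : Pred (BoundedPseudoHoop.Carrier A) ℓ} →
                       BoundedPseudoHoop.IsGood A →
                       BoundedPseudoHoop.IsInvolutiveFilter A F → BoundedPseudoHoop.IsFantasticFilter A F
involutive⇒fantastic A good (filter , involutive₁ , involutive₂) =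
  filter ,
  Good.involutive⇒fantastic₁ A good filter involutive₁ ,
  Good.involutive⇒fantastic₁ (opposite A) (opposite-isGood good) (opposite-isFilter filter) involutive₂
  where open Properties A

theorem4p22 : {a ℓ : Level} (A : BoundedPseudoHoop a) → BoundedPseudoHoop.IsGood A →
    (F : Pred (BoundedPseudoHoop.Carrier A) ℓ) →
      (BoundedPseudoHoop.IsFantasticFilter A F → BoundedPseudoHoop.IsInvolutiveFilter A F)
      × (BoundedPseudoHoop.IsInvolutiveFilter A F → BoundedPseudoHoop.IsFantasticFilter A F)
theorem4p22 A good F = fantastic⇒involutive A , involutive⇒fantastic A good
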